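{- Let $(K,\cdot,+,{}^{*},1,0,t,t')$ be a one-sorted Kleene algebra with tests and let $t(K)=\{x\in K\mid \exists y\in K.\ x=t(y)\}$. Then $(t(K),\cdot,+,1,0,t')$ (with operations restricted from $K$) is a Boolean algebra, with $\cdot$ as meet, $+$ as join and $t'$ as complement.
   Context: A Kleene algebra is an idempotent semiring $(K,\cdot,+,1,0)$ with a unary operation ${}^{*}$ such that $1+xx^{*}\le x^{*}$, $1+x^{*}x\le x^{*}$, $y+xz\le z\Rightarrow x^{*}y\le z$, and $y+zx\le z\Rightarrow yx^{*}\le z$, where $x\le y$ iff $x+y=y$. A one-sorted Kleene algebra with tests (KAt) is a Kleene algebra expanded with two unary operations $t,t'$ such that for all $x,y$: $t(0)=0$; $t(1)=1$; $t(t(x)+t(y))=t(x)+t(y)$; $t(t(x)t(y))=t(x)t(y)$; $t(x)t(x)=t(x)$; $t(x)\le 1$; $1\le t'(t(x))+t(x)$; $t'(t(x))\,t(x)\le 0$; $t'(t(x))=t(t'(t(x)))$. -}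

module Defs where

open import Level using (Level; suc)
open import Data.Product using (Σ; ∃; _,_; proj₁)
open import Relation.Binary.PropositionalEquality using (_≡_; cong; cong₂; sym; trans)

record KAt (a : Level) : Set (suc a) where
  infixl 7 _·_
  infixl 6 _+_
  infix  4 _≤_
  infixl 7 _·T_
  infixl 6 _+T_
  infix  4 _≈T_
  field
    K   : Set a
    _·_ : K → K → K
    _+_ : K → K → K
    _*  : K → K
    𝟏   : K
    𝟎   : K
    t   : K → K
    t'  : K → K

  _≤_ : K → K → Set a
  x ≤ y = x + y ≡ y

  field
    +-assoc   : ∀ x y z → (x + y) + z ≡ x + (y + z)
    +-comm    : ∀ x y → x + y ≡ y + x
    +-idem    : ∀ x → x + x ≡ x
    +-identityˡ : ∀ x → 𝟎 + x ≡ x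
    ·-assoc   : ∀ x y z → (x · y) · z ≡ x · (y · z)
    ·-identityˡ : ∀ x → 𝟏 · x ≡ x
    ·-identityʳ : ∀ x → x · 𝟏 ≡ x
    distribˡ  : ∀ x y z → x · (y + z) ≡ x · y + x · z
    distribʳ  : ∀ x y z → (y + z) · x ≡ y · x + z · x
    zeroˡ     : ∀ x → 𝟎 · x ≡ 𝟎
    zeroʳ     : ∀ x → x · 𝟎 ≡ 𝟎
    star-unfoldˡ : ∀ x → 𝟏 + x · (x *) ≤ x *
    star-unfoldʳ : ∀ x → 𝟏 + (x *) · x ≤ x *
    star-indˡ    : ∀ x y z → y + x · z ≤ z → (x *) · y ≤ z
    star-indʳ    : ∀ x y z → y + z · x ≤ z → y · (x *) ≤ z
    t-0      : t 𝟎 ≡ 𝟎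
    t-1      : t 𝟏 ≡ 𝟏
    t-+      : ∀ x y → t (t x + t y) ≡ t x + t y
    t-·      : ∀ x y → t (t x · t y) ≡ t x · t y
    t-idem   : ∀ x → t x · t x ≡ t x
    t-≤1     : ∀ x → t x ≤ 𝟏
    t'-compl₁ : ∀ x → 𝟏 ≤ t' (t x) + t x
    t'-compl₂ : ∀ x → t' (t x) · t x ≤ 𝟎
    t'-test  : ∀ x → t' (t x) ≡ t (t' (t x))

  TK : Set a
  TK = Σ K (λ x → ∃ λ y → x ≡ t y)

  _≈T_ : TK → TK → Set a
  p ≈T q = proj₁ p ≡ proj₁ q

  _·T_ : TK → TK → TK
  (x , y , e) ·T (x' , y' , e') = x · x' , (t y · t y') , trans (cong₂ _·_ e e') (sym (t-· y y'))

  _+T_ : TK → TK → TK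
  (x , y , e) +T (x' , y' , e') = x + x' , (t y + t y') , trans (cong₂ _+_ e e') (sym (t-+ y y'))

  t'T : TK → TK
  t'T (x , y , e) = t' x , t' (t y) , trans (cong t' e) (t'-test y)

  𝟏T : TK
  𝟏T = 𝟏 , 𝟏 , sym t-1

  𝟎T : TK
  𝟎T = 𝟎 , 𝟎 , sym t-0

-- The tests are subidentities p ≤ 1 that have a complement p' with p + p' = 1 and
-- p' p = 0.  A subidentity commutes with every complemented element q (it can only
-- be "cut down" on the q-side by multiplying with q + q' = 1), so multiplication
-- of tests is commutative, idempotent and distributes over +; absorption holds
-- because tests lie below 1; and the missing complement law p p' = 0 follows since
-- a left and a right complement of the same element coincide.  Distributivity of
-- + over · is then a formal consequence of the other lattice laws.
module Submission where

open import Defs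
open import Level using (Level)
open import Algebra.Lattice.Structures using (IsBooleanAlgebra)
open import Data.Product using (_,_; proj₁)
open import Relation.Binary.Bundles using (Setoid)
open import Relation.Binary.PropositionalEquality
import Relation.Binary.Construct.On as On
import Algebra.Consequences.Setoid as Consequences

module IdempotentSemiring {a : Level} (A : KAt a) where
  open KAt A
  open ≡-Reasoning

  +-identityʳ : ∀ x → x + 𝟎 ≡ x
  +-identityʳ x = trans (+-comm x 𝟎) (+-identityˡ x)

  ≤-antisym : ∀ {x y} → x ≤ y → y ≤ x → x ≡ y
  ≤-antisym {x} {y} x≤y y≤x = trans (sym y≤x) (trans (+-comm y x) x≤y)

  ≤𝟎⇒≡𝟎 : ∀ {x y} → x ≤ y → y ≡ 𝟎 → x ≡ 𝟎
  ≤𝟎⇒≡𝟎 {x} x≤y y≡𝟎 = begin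
    x      ≡⟨ sym (+-identityʳ x) ⟩
    x + 𝟎  ≡⟨ cong (x +_) (sym y≡𝟎) ⟩
    x + _  ≡⟨ x≤y ⟩
    _      ≡⟨ y≡𝟎 ⟩
    𝟎      ∎

  ·-monoʳ-≤ : ∀ z {x y} → x ≤ y → z · x ≤ z · y
  ·-monoʳ-≤ z {x} {y} x≤y = trans (sym (distribˡ z x y)) (cong (z ·_) x≤y)

  ·-monoˡ-≤ : ∀ z {x y} → x ≤ y → x · z ≤ y · z
  ·-monoˡ-≤ z {x} {y} x≤y = trans (sym (distribʳ z x y)) (cong (_· z) x≤y)

  ≤𝟏⇒·ʳ-≤ : ∀ {p} z → p ≤ 𝟏 → z · p ≤ z
  ≤𝟏⇒·ʳ-≤ {p} z p≤𝟏 = begin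
    z · p + z      ≡⟨ cong (z · p +_) (sym (·-identityʳ z)) ⟩
    z · p + z · 𝟏  ≡⟨ sym (distribˡ z p 𝟏) ⟩
    z · (p + 𝟏)    ≡⟨ cong (z ·_) p≤𝟏 ⟩
    z · 𝟏          ≡⟨ ·-identityʳ z ⟩
    z              ∎

  ≤𝟏⇒·ˡ-≤ : ∀ {p} z → p ≤ 𝟏 → p · z ≤ z
  ≤𝟏⇒·ˡ-≤ {p} z p≤𝟏 = begin
    p · z + z      ≡⟨ cong (p · z +_) (sym (·-identityˡ z)) ⟩
    p · z + 𝟏 · z  ≡⟨ sym (distribʳ z p 𝟏) ⟩
    (p + 𝟏) · z    ≡⟨ cong (_· z) p≤𝟏 ⟩
    𝟏 · z          ≡⟨ ·-identityˡ z ⟩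
    z              ∎

  complement-unique : ∀ {a b c} → c + b ≡ 𝟏 → c · b ≡ 𝟎 →
                      b + a ≡ 𝟏 → b · a ≡ 𝟎 → a ≡ c
  complement-unique {a} {b} {c} c+b≡𝟏 c·b≡𝟎 b+a≡𝟏 b·a≡𝟎 = begin
    a              ≡⟨ sym (·-identityˡ a) ⟩
    𝟏 · a          ≡⟨ cong (_· a) (sym c+b≡𝟏) ⟩
    (c + b) · a    ≡⟨ distribʳ a c b ⟩
    c · a + b · a  ≡⟨ cong (c · a +_) b·a≡𝟎 ⟩
    c · a + 𝟎      ≡⟨ +-identityʳ (c · a) ⟩
    c · a          ≡⟨ sym (+-identityˡ (c · a)) ⟩
    𝟎 + c · a      ≡⟨ cong (_+ c · a) (sym c·b≡𝟎) ⟩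
    c · b + c · a  ≡⟨ sym (distribˡ c b a) ⟩
    c · (b + a)    ≡⟨ cong (c ·_) b+a≡𝟏 ⟩
    c · 𝟏          ≡⟨ ·-identityʳ c ⟩
    c              ∎

  -- Both p q and q p equal q p q: the parts q' p q and q p q' lie below q' q = 0 and q q' = 0.
  ≤𝟏-comm-complemented : ∀ {p q q'} → p ≤ 𝟏 →
                         q + q' ≡ 𝟏 → q' · q ≡ 𝟎 → q · q' ≡ 𝟎 → p · q ≡ q · p
  ≤𝟏-comm-complemented {p} {q} {q'} p≤𝟏 q+q'≡𝟏 q'·q≡𝟎 q·q'≡𝟎 =
    trans pq≡qpq (sym qp≡qpq)
    where
    pq≡qpq : p · q ≡ q · (p · q)
    pq≡qpq = begin
      p · q                       ≡⟨ sym (·-identityˡ _) ⟩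
      𝟏 · (p · q)                 ≡⟨ cong (_· (p · q)) (sym q+q'≡𝟏) ⟩
      (q + q') · (p · q)          ≡⟨ distribʳ _ q q' ⟩
      q · (p · q) + q' · (p · q)  ≡⟨ cong (q · (p · q) +_) q'pq≡𝟎 ⟩
      q · (p · q) + 𝟎             ≡⟨ +-identityʳ _ ⟩
      q · (p · q)                 ∎
      where
      q'pq≡𝟎 : q' · (p · q) ≡ 𝟎
      q'pq≡𝟎 = ≤𝟎⇒≡𝟎 (·-monoʳ-≤ q' (≤𝟏⇒·ˡ-≤ q p≤𝟏)) q'·q≡𝟎
    qp≡qpq : q · p ≡ q · (p · q)
    qp≡qpq = begin
      q · p                       ≡⟨ sym (·-identityʳ _) ⟩
      (q · p) · 𝟏                 ≡⟨ cong ((q · p) ·_) (sym q+q'≡𝟏) ⟩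
      (q · p) · (q + q')          ≡⟨ distribˡ _ q q' ⟩
      (q · p) · q + (q · p) · q'  ≡⟨ cong ((q · p) · q +_) qpq'≡𝟎 ⟩
      (q · p) · q + 𝟎             ≡⟨ +-identityʳ _ ⟩
      (q · p) · q                 ≡⟨ ·-assoc q p q ⟩
      q · (p · q)                 ∎
      where
      qpq'≡𝟎 : (q · p) · q' ≡ 𝟎
      qpq'≡𝟎 = ≤𝟎⇒≡𝟎 (·-monoˡ-≤ q' (≤𝟏⇒·ʳ-≤ q p≤𝟏)) q·q'≡𝟎

  ≤𝟏-absorbs-· : ∀ {q} p → q ≤ 𝟏 → p + p · q ≡ p
  ≤𝟏-absorbs-· p q≤𝟏 = trans (+-comm _ _) (≤𝟏⇒·ʳ-≤ p q≤𝟏)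

  idem-absorbs-+ : ∀ {p q} → p · p ≡ p → q ≤ 𝟏 → p · (p + q) ≡ p
  idem-absorbs-+ {p} {q} p·p≡p q≤𝟏 = begin
    p · (p + q)    ≡⟨ distribˡ p p q ⟩
    p · p + p · q  ≡⟨ cong (_+ p · q) p·p≡p ⟩
    p + p · q      ≡⟨ ≤𝟏-absorbs-· p q≤𝟏 ⟩
    p              ∎

module Tests {a : Level} (A : KAt a) where
  open KAt A
  open IdempotentSemiring A

  t'-·-t : ∀ y → t' (t y) · t y ≡ 𝟎
  t'-·-t y = trans (sym (+-identityʳ _)) (t'-compl₂ y)

  t'-+-t : ∀ y → t' (t y) + t y ≡ 𝟏
  t'-+-t y = ≤-antisym t'+t≤𝟏 (t'-compl₁ y)
    where
    t'+t≤𝟏 : t' (t y) + t y ≤ 𝟏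
    t'+t≤𝟏 = begin
      (t' (t y) + t y) + 𝟏  ≡⟨ +-assoc _ _ _ ⟩
      t' (t y) + (t y + 𝟏)  ≡⟨ cong (t' (t y) +_) (t-≤1 y) ⟩
      t' (t y) + 𝟏          ≡⟨ cong (_+ 𝟏) (t'-test y) ⟩
      t (t' (t y)) + 𝟏      ≡⟨ t-≤1 _ ⟩
      𝟏                     ∎
      where open ≡-Reasoning

  t-+-t' : ∀ y → t y + t' (t y) ≡ 𝟏
  t-+-t' y = trans (+-comm _ _) (t'-+-t y)

  -- t y is a right complement of t' (t y), and t' (t (t' (t y))) a left one, so they coincide.
  t-·-t' : ∀ y → t y · t' (t y) ≡ 𝟎
  t-·-t' y = trans (cong₂ _·_ t≡t't't' (t'-test y)) (t'-·-t y')
    where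
    y' = t' (t y)
    t'≡tt' : t' (t y) ≡ t y'
    t'≡tt' = t'-test y
    t≡t't't' : t y ≡ t' (t y')
    t≡t't't' = complement-unique (t'-+-t y') (t'-·-t y')
      (trans (cong (_+ t y) (sym t'≡tt')) (t'-+-t y))
      (trans (cong (_· t y) (sym t'≡tt')) (t'-·-t y))

  t-comm : ∀ y z → t y · t z ≡ t z · t y
  t-comm y z = ≤𝟏-comm-complemented (t-≤1 y) (t-+-t' z) (t'-·-t z) (t-·-t' z)

  TK-setoid : Setoid a a
  TK-setoid = record
    { Carrier = TK ; _≈_ = _≈T_ ; isEquivalence = On.isEquivalence proj₁ isEquivalence }

  open Consequences TK-setoid using (distrib∧absorbs⇒distribˡ; comm∧distrˡ⇒distr)
  open import Algebra.Definitions _≈T_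

  +T-comm : Commutative _+T_
  +T-comm p q = +-comm (proj₁ p) (proj₁ q)

  +T-assoc : Associative _+T_
  +T-assoc p q r = +-assoc (proj₁ p) (proj₁ q) (proj₁ r)

  -- _≈T_ only sees first components, so Agda cannot infer the implicit arguments of
  -- these congruences; where they are passed on, the implicits are bound explicitly.
  +T-cong : Congruent₂ _+T_
  +T-cong p≈p' q≈q' = cong₂ _+_ p≈p' q≈q'

  ·T-comm : Commutative _·T_
  ·T-comm (_ , y , refl) (_ , z , refl) = t-comm y z

  ·T-assoc : Associative _·T_
  ·T-assoc p q r = ·-assoc (proj₁ p) (proj₁ q) (proj₁ r)

  ·T-cong : Congruent₂ _·T_
  ·T-cong p≈p' q≈q' = cong₂ _·_ p≈p' q≈q'

  +T-absorbs-·T : _+T_ Absorbs _·T_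
  +T-absorbs-·T (_ , _ , refl) (_ , z , refl) = ≤𝟏-absorbs-· _ (t-≤1 z)

  ·T-absorbs-+T : _·T_ Absorbs _+T_
  ·T-absorbs-+T (_ , y , refl) (_ , z , refl) = idem-absorbs-+ (t-idem y) (t-≤1 z)

  ·T-distrib-+T : _·T_ DistributesOver _+T_
  ·T-distrib-+T = (λ p q r → distribˡ (proj₁ p) (proj₁ q) (proj₁ r))
                , (λ p q r → distribʳ (proj₁ p) (proj₁ q) (proj₁ r))

  +T-distrib-·T : _+T_ DistributesOver _·T_
  +T-distrib-·T = comm∧distrˡ⇒distr {_+T_} {_·T_}
    (λ {p p' q q'} → ·T-cong {p} {p'} {q} {q'}) +T-comm
    (distrib∧absorbs⇒distribˡ {_+T_} {_·T_}
      (λ {p p' q q'} → +T-cong {p} {p'} {q} {q'}) +T-assoc ·T-comm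
      +T-absorbs-·T ·T-absorbs-+T ·T-distrib-+T)

  t'T-+T-inverse : Inverse 𝟏T t'T _+T_
  t'T-+T-inverse = (λ { (_ , y , refl) → t'-+-t y }) , (λ { (_ , y , refl) → t-+-t' y })

  t'T-·T-inverse : Inverse 𝟎T t'T _·T_
  t'T-·T-inverse = (λ { (_ , y , refl) → t'-·-t y }) , (λ { (_ , y , refl) → t-·-t' y })

  t'T-cong : Congruent₁ t'T
  t'T-cong p≈q = cong t' p≈q

mainTheorem3 : ∀ {a : Level} (A : KAt a) → let open KAt A in
    IsBooleanAlgebra _≈T_ _+T_ _·T_ t'T 𝟏T 𝟎T
mainTheorem3 A = record
  { isDistributiveLattice = record
    { isLattice = record
      { isEquivalence = Setoid.isEquivalence TK-setoid
      ; ∨-comm        = +T-comm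
      ; ∨-assoc       = +T-assoc
      ; ∨-cong        = λ {p p' q q'} → +T-cong {p} {p'} {q} {q'}
      ; ∧-comm        = ·T-comm
      ; ∧-assoc       = ·T-assoc
      ; ∧-cong        = λ {p p' q q'} → ·T-cong {p} {p'} {q} {q'}
      ; absorptive    = +T-absorbs-·T , ·T-absorbs-+T
      }
    ; ∨-distrib-∧ = +T-distrib-·T
    ; ∧-distrib-∨ = ·T-distrib-+T
    }
  ; ∨-complement = t'T-+T-inverse
  ; ∧-complement = t'T-·T-inverse
  ; ¬-cong       = λ {p q} → t'T-cong {p} {q}
  }
  where open Tests A
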